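{- $\kappa_4(S_4^2)\geqslant 10$ and $\kappa_5(S_4^2)\geqslant 12$.
   Context: For an integer $\ell\geqslant 2$ and a graph $G$, $\kappa_\ell(G)$ is the minimum number of vertices whose removal from $G$ results in a disconnected graph with at least $\ell$ components or a graph with fewer than $\ell$ vertices. The split-star $S_4^2$ has as vertex set all $24$ permutations $p=p_1p_2p_3p_4$ of $\{1,2,3,4\}$; $p\,g_{12}$ swaps the symbols in positions $1$ and $2$; for $i\in\{3,4\}$, $p\,g_i^+$ is obtained by swapping positions $2$ and $i$ then swapping positions $1$ and $2$, and $p\,g_i^-$ by swapping positions $1$ and $i$ then swapping positions $1$ and $2$. Vertices $p,q$ are adjacent iff $q=p\,g_{12}$ or $q\in\{p\,g_i^+,p\,g_i^-\}$ for some $i\in\{3,4\}$. -}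

module Defs where

open import Data.Nat using (ℕ; _≤_; _<_)
open import Data.Fin using (Fin; zero; suc)
open import Data.Fin.Permutation.Components using (transpose)
open import Data.Vec using (Vec; lookup; tabulate)
open import Data.List using (List; length)
open import Data.List.Membership.Propositional using (_∉_)
open import Data.List.Relation.Unary.All using (All)
open import Data.List.Relation.Unary.Unique.Propositional using (Unique)
open import Data.Product using (Σ; _×_)
open import Data.Sum using (_⊎_)
open import Relation.Nullary using (¬_)
open import Relation.Binary.PropositionalEquality using (_≡_)
open import Relation.Binary.Construct.Closure.ReflexiveTransitive using (Star)
open import Function.Definitions using (Injective)

-- A word p = p₁p₂p₃p₄ over {1,2,3,4}; position k (1-based) is index k-1.
Word : Set
Word = Vec (Fin 4) 4

IsPerm : Word → Set
IsPerm p = ∀ i j → lookup p i ≡ lookup p j → i ≡ j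

swap : Fin 4 → Fin 4 → Word → Word
swap i j p = tabulate (λ k → lookup p (transpose i j k))

pos1 pos2 : Fin 4
pos1 = zero
pos2 = suc zero

g12 : Word → Word
g12 p = swap pos1 pos2 p

g⁺ : Fin 4 → Word → Word
g⁺ i p = swap pos1 pos2 (swap pos2 i p)

g⁻ : Fin 4 → Word → Word
g⁻ i p = swap pos1 pos2 (swap pos1 i p)

pos3 pos4 : Fin 4
pos3 = suc (suc zero)
pos4 = suc (suc (suc zero))

Adj : Word → Word → Set
Adj p q = q ≡ g12 p
        ⊎ q ≡ g⁺ pos3 p ⊎ q ≡ g⁻ pos3 p
        ⊎ q ≡ g⁺ pos4 p ⊎ q ≡ g⁻ pos4 p

AdjOutside : List Word → Word → Word → Set
AdjOutside S p q = IsPerm p × IsPerm q × p ∉ S × q ∉ S × Adj p q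

Connected : List Word → Word → Word → Set
Connected S = Star (AdjOutside S)

AtLeastComponents : ℕ → List Word → Set
AtLeastComponents ℓ S =
  Σ (Fin ℓ → Word) λ v →
    (∀ i → IsPerm (v i)) × (∀ i → v i ∉ S) ×
    (∀ i j → ¬ (i ≡ j) → ¬ Connected S (v i) (v j))

FewerVertices : ℕ → List Word → Set
FewerVertices ℓ S =
  ¬ Σ (Fin ℓ → Word) λ v →
      Injective _≡_ _≡_ v × (∀ i → IsPerm (v i)) × (∀ i → v i ∉ S)

Separates : ℕ → List Word → Set
Separates ℓ S = AtLeastComponents ℓ S ⊎ FewerVertices ℓ S

κ≥ : ℕ → ℕ → Set
κ≥ ℓ k = (S : List Word) → Unique S → All IsPerm S → Separates ℓ S → k ≤ length S

{-# OPTIONS --safe #-}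
-- Relabelling the symbols of all vertices is an automorphism of S_4^2, so when S_4^2 − S has
-- ℓ components we may assume that one of them contains 1234.  Pick a vertex (a terminal) in
-- each component.  For every possible choice of the other ℓ − 1 terminals, a branch-and-bound
-- search evaluated by the type checker shows that at least K vertices must be removed to
-- separate them: a vertex next to the component of a terminal is either removed or joins that
-- component, and the components of two terminals are never adjacent.  If instead fewer than ℓ
-- vertices survive, then |S| ≥ 24 − (ℓ − 1) ≥ K.
module Submission where

open import Defs
open import Data.Bool using (Bool; true; false; _∧_; _∨_; not; if_then_else_; T)
open import Data.Bool.ListAction using (all)
open import Data.Bool.Properties using (T-∧; T-∨; T-≡)
open import Data.Fin using (Fin; zero; suc; inject≤) renaming (_≟_ to _≟ᶠ_)
open import Data.Fin.Properties using (all?; any?; injective⇒≤; inject≤-injective; suc-injective)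
open import Data.List using (List; []; _∷_; _++_; map; length; lookup; take; filter; filterᵇ)
open import Data.List.Properties
  using (length-map; length-take; length-tabulate; length-++; map-∘; map-cong; map-id)
open import Data.List.Membership.Propositional using (_∈_; _∉_)
open import Data.List.Membership.Propositional.Properties
  using (∈-lookup; ∈-map⁺; ∈-map⁻; ∈-++⁺ˡ; ∈-++⁺ʳ; ∈-filter⁺; ∈-filter⁻; ∈-tabulate⁻)
open import Data.List.Membership.DecPropositional using () renaming (_∈?_ to member?)
open import Data.List.Relation.Binary.Subset.Propositional using (_⊆_)
open import Data.List.Relation.Binary.Sublist.Propositional as Sublist using ([]; _∷_; _∷ʳ_; ⊆-trans)
open import Data.List.Relation.Binary.Sublist.Propositional.Properties using (take-⊆; filter-⊆)
open import Data.List.Relation.Unary.All as All using (All; _∷_)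
open import Data.List.Relation.Unary.All.Properties using (all-filter; take⁺; all⁺) renaming (map⁺ to All-map⁺)
open import Data.List.Relation.Unary.AllPairs using (allPairs?)
open import Data.List.Relation.Unary.Any as Any using (here; there)
open import Data.List.Relation.Unary.Any.Properties using (lookup-index)
open import Data.List.Relation.Unary.Unique.Propositional using (Unique; _∷_)
import Data.List.Relation.Unary.Unique.Propositional.Properties as Unique
open import Data.Nat using (ℕ; zero; suc; _+_; _≤_; _≤ᵇ_; _≤?_; s≤s) renaming (_≟_ to _≟ⁿ_)
open import Data.Nat.Properties using (≤-trans; ≤ᵇ⇒≤; m≤n⇒m⊓n≡m; +-cancelˡ-≤; +-monoˡ-≤; ≰⇒>; m≤m+n)
open import Data.Product using (Σ; ∃; ∃₂; _×_; _,_; proj₁; proj₂)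
open import Data.Sum using (inj₁; inj₂)
open import Data.Unit using (⊤; tt)
open import Data.Vec using (_∷_; [])
import Data.Vec as Vec
import Data.Vec.Properties as Vecₚ
open import Data.Empty using (⊥-elim)
open import Function using (_∘_; id)
open import Level using (0ℓ)
open import Function.Bundles using (Equivalence)
open import Relation.Binary using (Rel; Reflexive; Symmetric; Transitive)
open import Relation.Binary.Construct.Closure.ReflexiveTransitive as Star using (ε; _◅_; _◅◅_)
open import Relation.Binary.Definitions using (DecidableEquality)
open import Relation.Binary.PropositionalEquality using (_≡_; _≢_; _≗_; refl; sym; trans; cong; subst; subst₂)
open import Relation.Nullary using (¬_; Dec; yes; no; does; contradiction)
open import Relation.Nullary.Decidable using (map′; _→-dec_; ¬?; T?; toWitness; decidable-stable)
open import Relation.Unary using (Pred; Decidable)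

private variable
  A : Set

lookup-injective : {xs : List A} → Unique xs → ∀ i j → lookup xs i ≡ lookup xs j → i ≡ j
lookup-injective {xs = _ ∷ _} _          zero    zero    _  = refl
lookup-injective {xs = _ ∷ _} (x∉xs ∷ _) zero    (suc j) eq = ⊥-elim (All.lookup x∉xs (∈-lookup j) eq)
lookup-injective {xs = _ ∷ _} (x∉xs ∷ _) (suc i) zero    eq = ⊥-elim (All.lookup x∉xs (∈-lookup i) (sym eq))
lookup-injective {xs = _ ∷ _} (_ ∷ u)    (suc i) (suc j) eq = cong suc (lookup-injective u i j eq)

unique-⊆⇒length≤ : {xs ys : List A} → Unique xs → xs ⊆ ys → length xs ≤ length ys
unique-⊆⇒length≤ {xs = xs} {ys} unique xs⊆ys = injective⇒≤ position-injective
  where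
  position : Fin (length xs) → Fin (length ys)
  position i = Any.index (xs⊆ys (∈-lookup i))

  position-injective : ∀ {i j} → position i ≡ position j → i ≡ j
  position-injective {i} {j} eq = lookup-injective unique i j
    (trans (lookup-index (xs⊆ys (∈-lookup i)))
      (trans (cong (lookup ys) eq) (sym (lookup-index (xs⊆ys (∈-lookup j))))))

combinations : ℕ → List A → List (List A)
combinations zero    _        = [] ∷ []
combinations (suc k) []       = []
combinations (suc k) (x ∷ xs) = map (x ∷_) (combinations k xs) ++ combinations (suc k) xs

sublist-∈-combinations : {xs ys : List A} → xs Sublist.⊆ ys → xs ∈ combinations (length xs) ys
sublist-∈-combinations []                   = here refl
sublist-∈-combinations {xs = []}    (y ∷ʳ τ) = here refl
sublist-∈-combinations {xs = _ ∷ _} (y ∷ʳ τ) = ∈-++⁺ʳ _ (sublist-∈-combinations τ)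
sublist-∈-combinations (refl ∷ τ)           = ∈-++⁺ˡ (∈-map⁺ _ (sublist-∈-combinations τ))

-- Searching for a separating set

module Search
  {V : Set} (_≟_ : DecidableEquality V) (vertices : List V)
  {Slot : Set} (slots : List Slot) (neighbour : V → Slot → V)
  {Table : Set → Set} (memo : ∀ {A : Set} → (V → A) → Table A) (_!_ : ∀ {A : Set} → Table A → V → A)
  (memo-! : ∀ {A : Set} (f : V → A) x → memo f ! x ≡ f x)
  where

  -- joined a: the vertex lies in the component of the terminal a
  data Cell : Set where
    unknown deleted : Cell
    joined          : V → Cell

  -- States are tabulated so that each cell is computed once rather than on every lookup.
  State : Set
  State = Table Cell

  _[_≔_] : State → V → Cell → State
  st [ x ≔ c ] = memo λ y → if does (x ≟ y) then c else st ! y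

  initial : List V → State
  initial ts = memo λ y → if does (member? _≟_ y ts) then joined y else unknown

  isDeleted isUnknown isJoined : Cell → Bool
  isDeleted deleted    = true
  isDeleted _          = false
  isUnknown unknown    = true
  isUnknown _          = false
  isJoined  (joined _) = true
  isJoined  _          = false

  clashes : Cell → Cell → Bool
  clashes (joined a) (joined b) = not (does (a ≟ b))
  clashes _          _          = false

  deletedCount : State → ℕ
  deletedCount st = length (filterᵇ (isDeleted ∘ (st !_)) vertices)

  data Move : Set where
    stuck       : Move
    clashAt     : V → Slot → Move
    forceDelete : V → Slot → Slot → Move
    branchAt    : V → Slot → ℕ → Move

  module Heuristic (st : State) where

    cell : V → Slot → Cell
    cell x k = st ! neighbour x k

    freedom : V → ℕ
    freedom x = length (filterᵇ (isUnknown ∘ cell x) slots)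

    better : Move → Move → Move
    better (branchAt x k m) (branchAt y j n) = if n ≤ᵇ m then branchAt x k m else branchAt y j n
    better stuck            new              = new
    better best             _                = best

    clashWith : Cell → V → Slot → List Slot → Move → Move
    clashWith c x k []       best = best
    clashWith c x k (j ∷ js) best = if clashes c (cell x j) then forceDelete x k j else clashWith c x k js best

    examineUnknown : V → List Slot → Move → Move
    examineUnknown x []       best = best
    examineUnknown x (k ∷ ks) best =
      if isJoined (cell x k)
      then clashWith (cell x k) x k slots (better best (branchAt x k (freedom x)))
      else examineUnknown x ks best

    examineJoined : V → List Slot → Move → Move
    examineJoined x []       best = best
    examineJoined x (k ∷ ks) best = if clashes (st ! x) (cell x k) then clashAt x k else examineJoined x ks best

    examine : V → Cell → Move → Move
    examine x unknown    = examineUnknown x slots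
    examine x deleted    = id
    examine x (joined _) = examineJoined x slots

    mutual
      scan : List V → Move → Move
      scan []       best = best
      scan (x ∷ xs) best = continue xs (examine x (st ! x) best)

      continue : List V → Move → Move
      continue xs stuck               = scan xs stuck
      continue xs (clashAt x k)       = clashAt x k
      continue xs (forceDelete x k j) = forceDelete x k j
      continue xs (branchAt x k n)    = scan xs (branchAt x k n)

  -- The heuristic is untrusted: follow re-checks everything soundness relies on.
  nextMove : State → Move
  nextMove st = Heuristic.scan st vertices stuck

  module _ (K : ℕ) where
    mutual
      check : ℕ → State → Bool
      check zero       st = false
      check (suc fuel) st = (K ≤ᵇ deletedCount st) ∨ follow fuel st (nextMove st)

      follow : ℕ → State → Move → Bool
      follow fuel st stuck               = false
      follow fuel st (clashAt x k)       = clashes (st ! x) (st ! neighbour x k)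
      follow fuel st (forceDelete x j k) =
        clashes (st ! neighbour x j) (st ! neighbour x k) ∧ check fuel (st [ x ≔ deleted ])
      follow fuel st (branchAt x k _)    = branch fuel st x (st ! neighbour x k)

      branch : ℕ → State → V → Cell → Bool
      branch fuel st x (joined a) = check fuel (st [ x ≔ deleted ]) ∧ check fuel (st [ x ≔ joined a ])
      branch fuel st x _          = false

  Clash : Cell → Cell → Set
  Clash c c′ = ∃₂ λ a b → c ≡ joined a × c′ ≡ joined b × a ≢ b

  clashes-sound : ∀ c c′ → T (clashes c c′) → Clash c c′
  clashes-sound (joined a) (joined b) _ with a ≟ b
  ... | no a≢b = a , b , refl , refl , a≢b

  module Soundness
    (K : ℕ) (ts : List V) (Deleted : Pred V 0ℓ) (Deleted? : Decidable Deleted)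
    (Linked : Rel V 0ℓ) (linked-refl : Reflexive Linked) (linked-sym : Symmetric Linked)
    (linked-trans : Transitive Linked)
    (neighbour-linked : ∀ {x} k → ¬ Deleted x → ¬ Deleted (neighbour x k) → Linked x (neighbour x k))
    (terminal-undeleted : ∀ {a} → a ∈ ts → ¬ Deleted a)
    (terminals-separated : ∀ {a b} → a ∈ ts → b ∈ ts → a ≢ b → ¬ Linked a b)
    (N : ℕ) (budget : ∀ {xs} → Unique xs → All Deleted xs → length xs ≤ N)
    (vertices-unique : Unique vertices)
    where

    CellSound : V → Cell → Set
    CellSound x unknown    = ⊤
    CellSound x deleted    = Deleted x
    CellSound x (joined a) = a ∈ ts × ¬ Deleted x × Linked a x

    Consistent : State → Set
    Consistent st = ∀ x → CellSound x (st ! x)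

    consistent-update : ∀ {st x c} → Consistent st → CellSound x c → Consistent (st [ x ≔ c ])
    consistent-update {st} {x} {c} consistent sound y
      rewrite memo-! (λ y → if does (x ≟ y) then c else st ! y) y with x ≟ y
    ... | yes refl = sound
    ... | no _     = consistent y

    initial-consistent : Consistent (initial ts)
    initial-consistent y
      rewrite memo-! (λ y → if does (member? _≟_ y ts) then joined y else unknown) y with member? _≟_ y ts
    ... | yes y∈ts = y∈ts , terminal-undeleted y∈ts , linked-refl
    ... | no _     = tt

    deletedCount≤N : ∀ st → Consistent st → deletedCount st ≤ N
    deletedCount≤N st consistent =
      budget (Unique.filter⁺ (T? ∘ isDeleted ∘ (st !_)) vertices-unique)
             (All.map (λ {x} → marked-deleted (consistent x)) (all-filter (T? ∘ isDeleted ∘ (st !_)) vertices))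
      where
      marked-deleted : ∀ {x c} → CellSound x c → T (isDeleted c) → Deleted x
      marked-deleted {c = deleted} deleted-x _ = deleted-x

    joined-sound : ∀ st {x a} → Consistent st → st ! x ≡ joined a → CellSound x (joined a)
    joined-sound st {x} consistent eq = subst (CellSound x) eq (consistent x)

    clash⇒undeleted : ∀ st {x y} → Consistent st → Clash (st ! x) (st ! y) → ¬ Deleted x × ¬ Deleted y
    clash⇒undeleted st consistent (_ , _ , eqa , eqb , _) =
      proj₁ (proj₂ (joined-sound st consistent eqa)) , proj₁ (proj₂ (joined-sound st consistent eqb))

    clash⇒unlinked : ∀ st {x y} → Consistent st → Clash (st ! x) (st ! y) → ¬ Linked x y
    clash⇒unlinked st consistent (_ , _ , eqa , eqb , a≢b) x~y
      with (a∈ts , _ , a~x) ← joined-sound st consistent eqa | (b∈ts , _ , b~y) ← joined-sound st consistent eqb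
      = terminals-separated a∈ts b∈ts a≢b (linked-trans a~x (linked-trans x~y (linked-sym b~y)))

    mutual
      sound : ∀ fuel st → Consistent st → T (check K fuel st) → K ≤ N
      sound (suc fuel) st consistent ok with Equivalence.to T-∨ ok
      ... | inj₁ enough   = ≤-trans (≤ᵇ⇒≤ K (deletedCount st) enough) (deletedCount≤N st consistent)
      ... | inj₂ followed = sound-follow fuel st (nextMove st) consistent followed

      sound-follow : ∀ fuel st move → Consistent st → T (follow K fuel st move) → K ≤ N
      sound-follow fuel st (clashAt x k) consistent ok =
        let clash = clashes-sound (st ! x) (st ! neighbour x k) ok
            (x-undeleted , y-undeleted) = clash⇒undeleted st consistent clash
        in contradiction (neighbour-linked k x-undeleted y-undeleted) (clash⇒unlinked st consistent clash)
      sound-follow fuel st (forceDelete x j k) consistent ok with Equivalence.to T-∧ ok | Deleted? x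
      ... | _ , ok-deleted | yes deleted-x =
        sound fuel (st [ x ≔ deleted ]) (consistent-update consistent deleted-x) ok-deleted
      -- an undeleted x would link the components of its j-th and k-th neighbours
      ... | clashing , _   | no undeleted =
        let clash = clashes-sound (st ! neighbour x j) (st ! neighbour x k) clashing
            (j-undeleted , k-undeleted) = clash⇒undeleted st consistent clash
        in contradiction (linked-trans (linked-sym (neighbour-linked j undeleted j-undeleted))
                                       (neighbour-linked k undeleted k-undeleted))
                         (clash⇒unlinked st consistent clash)
      sound-follow fuel st (branchAt x k _) consistent ok =
        sound-branch fuel st x k (st ! neighbour x k) refl consistent ok

      sound-branch : ∀ fuel st x k c → st ! neighbour x k ≡ c → Consistent st →
                     T (branch K fuel st x c) → K ≤ N
      sound-branch fuel st x k (joined a) eq consistent ok with Deleted? x | Equivalence.to T-∧ ok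
      ... | yes deleted-x | ok-deleted , _ =
        sound fuel (st [ x ≔ deleted ]) (consistent-update consistent deleted-x) ok-deleted
      ... | no undeleted  | _ , ok-joined
          with (a∈ts , y-undeleted , a~y) ← joined-sound st consistent eq =
        sound fuel (st [ x ≔ joined a ])
          (consistent-update consistent
            (a∈ts , undeleted , linked-trans a~y (linked-sym (neighbour-linked k undeleted y-undeleted))))
          ok-joined

    sound-initial : ∀ fuel → T (check K fuel (initial ts)) → K ≤ N
    sound-initial fuel = sound fuel (initial ts) initial-consistent

-- The split-star S_4^2

pattern ① = zero
pattern ② = suc ①
pattern ③ = suc ②
pattern ④ = suc ③

data Generator : Set where
  g₁₂ g₃⁺ g₃⁻ g₄⁺ g₄⁻ : Generator

generators : List Generator
generators = g₁₂ ∷ g₃⁺ ∷ g₃⁻ ∷ g₄⁺ ∷ g₄⁻ ∷ []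

∀-generator? : {P : Generator → Set} → Decidable P → Dec (∀ k → P k)
∀-generator? P? = map′ (λ h k → All.lookup h (complete k)) (λ h → All.tabulate λ {k} _ → h k)
  (All.all? P? generators)
  where
  complete : ∀ k → k ∈ generators
  complete g₁₂ = here refl
  complete g₃⁺ = there (here refl)
  complete g₃⁻ = there (there (here refl))
  complete g₄⁺ = there (there (there (here refl)))
  complete g₄⁻ = there (there (there (there (here refl))))

generator : Generator → Word → Word
generator g₁₂ = g12
generator g₃⁺ = g⁺ pos3
generator g₃⁻ = g⁻ pos3
generator g₄⁺ = g⁺ pos4
generator g₄⁻ = g⁻ pos4

adj⇒generator : ∀ {p q} → Adj p q → ∃ λ k → q ≡ generator k p
adj⇒generator (inj₁ eq)                      = g₁₂ , eq
adj⇒generator (inj₂ (inj₁ eq))               = g₃⁺ , eq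
adj⇒generator (inj₂ (inj₂ (inj₁ eq)))        = g₃⁻ , eq
adj⇒generator (inj₂ (inj₂ (inj₂ (inj₁ eq)))) = g₄⁺ , eq
adj⇒generator (inj₂ (inj₂ (inj₂ (inj₂ eq)))) = g₄⁻ , eq

generator⇒adj : ∀ k p → Adj p (generator k p)
generator⇒adj g₁₂ p = inj₁ refl
generator⇒adj g₃⁺ p = inj₂ (inj₁ refl)
generator⇒adj g₃⁻ p = inj₂ (inj₂ (inj₁ refl))
generator⇒adj g₄⁺ p = inj₂ (inj₂ (inj₂ (inj₁ refl)))
generator⇒adj g₄⁻ p = inj₂ (inj₂ (inj₂ (inj₂ refl)))

inverseGenerator : Generator → Generator
inverseGenerator g₁₂ = g₁₂
inverseGenerator g₃⁺ = g₃⁻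
inverseGenerator g₃⁻ = g₃⁺
inverseGenerator g₄⁺ = g₄⁻
inverseGenerator g₄⁻ = g₄⁺

generator-inverse : ∀ k p → generator (inverseGenerator k) (generator k p) ≡ p
generator-inverse g₁₂ (_ ∷ _ ∷ _ ∷ _ ∷ []) = refl
generator-inverse g₃⁺ (_ ∷ _ ∷ _ ∷ _ ∷ []) = refl
generator-inverse g₃⁻ (_ ∷ _ ∷ _ ∷ _ ∷ []) = refl
generator-inverse g₄⁺ (_ ∷ _ ∷ _ ∷ _ ∷ []) = refl
generator-inverse g₄⁻ (_ ∷ _ ∷ _ ∷ _ ∷ []) = refl

adj-sym : ∀ {p q} → Adj p q → Adj q p
adj-sym {p} adj with adj⇒generator {p} adj
... | k , refl =
  subst (Adj (generator k p)) (generator-inverse k p) (generator⇒adj (inverseGenerator k) (generator k p))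

connected-sym : ∀ {S p q} → Connected S p q → Connected S q p
connected-sym = Star.reverse λ (perm-p , perm-q , p∉S , q∉S , adj) → perm-q , perm-p , q∉S , p∉S , adj-sym adj

relabel : (Fin 4 → Fin 4) → Word → Word
relabel = Vec.map

relabel-generator : ∀ σ k p → relabel σ (generator k p) ≡ generator k (relabel σ p)
relabel-generator σ g₁₂ (_ ∷ _ ∷ _ ∷ _ ∷ []) = refl
relabel-generator σ g₃⁺ (_ ∷ _ ∷ _ ∷ _ ∷ []) = refl
relabel-generator σ g₃⁻ (_ ∷ _ ∷ _ ∷ _ ∷ []) = refl
relabel-generator σ g₄⁺ (_ ∷ _ ∷ _ ∷ _ ∷ []) = refl
relabel-generator σ g₄⁻ (_ ∷ _ ∷ _ ∷ _ ∷ []) = refl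

relabel-adj : ∀ σ {p q} → Adj p q → Adj (relabel σ p) (relabel σ q)
relabel-adj σ {p} adj with adj⇒generator {p} adj
... | k , refl = subst (Adj (relabel σ p)) (sym (relabel-generator σ k p)) (generator⇒adj k (relabel σ p))

relabel-inverse : ∀ σ τ → τ ∘ σ ≗ id → ∀ p → relabel τ (relabel σ p) ≡ p
relabel-inverse σ τ τσ p = trans (sym (Vecₚ.map-∘ τ σ p)) (trans (Vecₚ.map-cong τσ p) (Vecₚ.map-id p))

module _ (σ τ : Fin 4 → Fin 4) (τσ : τ ∘ σ ≗ id) where

  relabel-injective : ∀ {p q} → relabel σ p ≡ relabel σ q → p ≡ q
  relabel-injective {p} {q} eq =
    trans (sym (relabel-inverse σ τ τσ p)) (trans (cong (relabel τ) eq) (relabel-inverse σ τ τσ q))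

  relabel-isPerm : ∀ {p} → IsPerm p → IsPerm (relabel σ p)
  relabel-isPerm {p} perm i j eq = perm i j
    (trans (sym (τσ _))
      (trans (cong τ (trans (sym (Vecₚ.lookup-map i σ p)) (trans eq (Vecₚ.lookup-map j σ p)))) (τσ _)))

  relabel-∉ : ∀ {p S} → p ∉ S → relabel σ p ∉ map (relabel σ) S
  relabel-∉ {S = S} p∉S σp∈σS with ∈-map⁻ (relabel σ) σp∈σS
  ... | q , q∈S , eq = p∉S (subst (_∈ S) (sym (relabel-injective eq)) q∈S)

  relabel-connected : ∀ {S p q} → Connected S p q → Connected (map (relabel σ) S) (relabel σ p) (relabel σ q)
  relabel-connected {S} = Star.gmap (relabel σ) λ {p} {q} (perm-p , perm-q , p∉S , q∉S , adj) →
    relabel-isPerm {p} perm-p , relabel-isPerm {q} perm-q ,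
    relabel-∉ {p} {S} p∉S , relabel-∉ {q} {S} q∉S , relabel-adj σ {p} adj

Representatives : (ℓ : ℕ) → List Word → (Fin ℓ → Word) → Set
Representatives ℓ S v =
  (∀ i → IsPerm (v i)) × (∀ i → v i ∉ S) × (∀ i j → ¬ i ≡ j → ¬ Connected S (v i) (v j))

relabel-representatives : ∀ σ τ → σ ∘ τ ≗ id → τ ∘ σ ≗ id → ∀ {ℓ S v} →
  Representatives ℓ S v → Representatives ℓ (map (relabel σ) S) (relabel σ ∘ v)
relabel-representatives σ τ στ τσ {S = S} {v} (perm , outside , apart) =
  (λ i → relabel-isPerm σ τ τσ {v i} (perm i)) , (λ i → relabel-∉ σ τ τσ {S = S} (outside i)) ,
  λ i j i≢j σv-connected → apart i j i≢j
    (subst₂ (λ S′ p → Connected S′ p (v j)) S-restored (relabel-inverse σ τ τσ (v i))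
      (subst (Connected _ _) (relabel-inverse σ τ τσ (v j)) (relabel-connected τ σ στ σv-connected)))
  where
  S-restored : map (relabel τ) (map (relabel σ) S) ≡ S
  S-restored = trans (sym (map-∘ S)) (trans (map-cong (relabel-inverse σ τ τσ) S) (map-id S))

data V : Set where
  p1234 p1243 p1324 p1342 p1423 p1432 p2134 p2143 p2314 p2341 p2413 p2431 : V
  p3124 p3142 p3214 p3241 p3412 p3421 p4123 p4132 p4213 p4231 p4312 p4321 : V

word : V → Word
word p1234 = ① ∷ ② ∷ ③ ∷ ④ ∷ []
word p1243 = ① ∷ ② ∷ ④ ∷ ③ ∷ []
word p1324 = ① ∷ ③ ∷ ② ∷ ④ ∷ []
word p1342 = ① ∷ ③ ∷ ④ ∷ ② ∷ []
word p1423 = ① ∷ ④ ∷ ② ∷ ③ ∷ []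
word p1432 = ① ∷ ④ ∷ ③ ∷ ② ∷ []
word p2134 = ② ∷ ① ∷ ③ ∷ ④ ∷ []
word p2143 = ② ∷ ① ∷ ④ ∷ ③ ∷ []
word p2314 = ② ∷ ③ ∷ ① ∷ ④ ∷ []
word p2341 = ② ∷ ③ ∷ ④ ∷ ① ∷ []
word p2413 = ② ∷ ④ ∷ ① ∷ ③ ∷ []
word p2431 = ② ∷ ④ ∷ ③ ∷ ① ∷ []
word p3124 = ③ ∷ ① ∷ ② ∷ ④ ∷ []
word p3142 = ③ ∷ ① ∷ ④ ∷ ② ∷ []
word p3214 = ③ ∷ ② ∷ ① ∷ ④ ∷ []
word p3241 = ③ ∷ ② ∷ ④ ∷ ① ∷ []
word p3412 = ③ ∷ ④ ∷ ① ∷ ② ∷ []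
word p3421 = ③ ∷ ④ ∷ ② ∷ ① ∷ []
word p4123 = ④ ∷ ① ∷ ② ∷ ③ ∷ []
word p4132 = ④ ∷ ① ∷ ③ ∷ ② ∷ []
word p4213 = ④ ∷ ② ∷ ① ∷ ③ ∷ []
word p4231 = ④ ∷ ② ∷ ③ ∷ ① ∷ []
word p4312 = ④ ∷ ③ ∷ ① ∷ ② ∷ []
word p4321 = ④ ∷ ③ ∷ ② ∷ ① ∷ []

-- inverse of word; the last clause is a junk value for words that are not permutations
vertex : Word → V
vertex (① ∷ ② ∷ ③ ∷ ④ ∷ []) = p1234
vertex (① ∷ ② ∷ ④ ∷ ③ ∷ []) = p1243
vertex (① ∷ ③ ∷ ② ∷ ④ ∷ []) = p1324
vertex (① ∷ ③ ∷ ④ ∷ ② ∷ []) = p1342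
vertex (① ∷ ④ ∷ ② ∷ ③ ∷ []) = p1423
vertex (① ∷ ④ ∷ ③ ∷ ② ∷ []) = p1432
vertex (② ∷ ① ∷ ③ ∷ ④ ∷ []) = p2134
vertex (② ∷ ① ∷ ④ ∷ ③ ∷ []) = p2143
vertex (② ∷ ③ ∷ ① ∷ ④ ∷ []) = p2314
vertex (② ∷ ③ ∷ ④ ∷ ① ∷ []) = p2341
vertex (② ∷ ④ ∷ ① ∷ ③ ∷ []) = p2413
vertex (② ∷ ④ ∷ ③ ∷ ① ∷ []) = p2431
vertex (③ ∷ ① ∷ ② ∷ ④ ∷ []) = p3124
vertex (③ ∷ ① ∷ ④ ∷ ② ∷ []) = p3142
vertex (③ ∷ ② ∷ ① ∷ ④ ∷ []) = p3214
vertex (③ ∷ ② ∷ ④ ∷ ① ∷ []) = p3241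
vertex (③ ∷ ④ ∷ ① ∷ ② ∷ []) = p3412
vertex (③ ∷ ④ ∷ ② ∷ ① ∷ []) = p3421
vertex (④ ∷ ① ∷ ② ∷ ③ ∷ []) = p4123
vertex (④ ∷ ① ∷ ③ ∷ ② ∷ []) = p4132
vertex (④ ∷ ② ∷ ① ∷ ③ ∷ []) = p4213
vertex (④ ∷ ② ∷ ③ ∷ ① ∷ []) = p4231
vertex (④ ∷ ③ ∷ ① ∷ ② ∷ []) = p4312
vertex (④ ∷ ③ ∷ ② ∷ ① ∷ []) = p4321
vertex _ = p1234

vertex-word : ∀ x → vertex (word x) ≡ x
vertex-word p1234 = refl
vertex-word p1243 = refl
vertex-word p1324 = refl
vertex-word p1342 = refl
vertex-word p1423 = refl
vertex-word p1432 = refl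
vertex-word p2134 = refl
vertex-word p2143 = refl
vertex-word p2314 = refl
vertex-word p2341 = refl
vertex-word p2413 = refl
vertex-word p2431 = refl
vertex-word p3124 = refl
vertex-word p3142 = refl
vertex-word p3214 = refl
vertex-word p3241 = refl
vertex-word p3412 = refl
vertex-word p3421 = refl
vertex-word p4123 = refl
vertex-word p4132 = refl
vertex-word p4213 = refl
vertex-word p4231 = refl
vertex-word p4312 = refl
vertex-word p4321 = refl

vertices others : List V
vertices = p1234 ∷ others
others = p1243 ∷ p1324 ∷ p1342 ∷ p1423 ∷ p1432 ∷ p2134 ∷ p2143 ∷ p2314 ∷ p2341 ∷ p2413 ∷ p2431 ∷
         p3124 ∷ p3142 ∷ p3214 ∷ p3241 ∷ p3412 ∷ p3421 ∷ p4123 ∷ p4132 ∷ p4213 ∷ p4231 ∷ p4312 ∷ p4321 ∷ []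

_≟ʷ_ : DecidableEquality Word
_≟ʷ_ = Vecₚ.≡-dec _≟ᶠ_

word-injective : ∀ {x y} → word x ≡ word y → x ≡ y
word-injective {x} {y} eq = trans (sym (vertex-word x)) (trans (cong vertex eq) (vertex-word y))

∀-word? : {P : Word → Set} → Decidable P → Dec (∀ p → P p)
∀-word? P? = map′ (λ h → λ { (a ∷ b ∷ c ∷ d ∷ []) → h a b c d }) (λ h a b c d → h _)
  (all? λ a → all? λ b → all? λ c → all? λ d → P? (a ∷ b ∷ c ∷ d ∷ []))

vertices-complete : ∀ x → x ∈ vertices
vertices-complete x = subst (_∈ vertices) (vertex-word x) (vertex-∈ (word x))
  where
  vertex-∈ : ∀ p → vertex p ∈ vertices
  vertex-∈ = toWitness {a? = ∀-word? λ p →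
    Any.any? (λ y → map′ (word-injective ∘ sym) (sym ∘ cong word) (word y ≟ʷ word (vertex p))) vertices} _

∀-vertex? : {P : V → Set} → Decidable P → Dec (∀ x → P x)
∀-vertex? P? = map′ (λ h x → All.lookup h (vertices-complete x)) (λ h → All.tabulate λ {x} _ → h x)
  (All.all? P? vertices)

index : V → ℕ
index p1234 = 0
index p1243 = 1
index p1324 = 2
index p1342 = 3
index p1423 = 4
index p1432 = 5
index p2134 = 6
index p2143 = 7
index p2314 = 8
index p2341 = 9
index p2413 = 10
index p2431 = 11
index p3124 = 12
index p3142 = 13
index p3214 = 14
index p3241 = 15
index p3412 = 16
index p3421 = 17
index p4123 = 18
index p4132 = 19
index p4213 = 20
index p4231 = 21
index p4312 = 22
index p4321 = 23

index-injective : ∀ {x y} → index x ≡ index y → x ≡ y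
index-injective {x} {y} eq = word-injective (toWitness {a? = ∀-vertex? λ x → ∀-vertex? λ y →
  (index x ≟ⁿ index y) →-dec (word x ≟ʷ word y)} _ x y eq)

-- Comparing indices is much cheaper than comparing words, which matters for the search.
_≟_ : DecidableEquality V
x ≟ y = map′ index-injective (cong index) (index x ≟ⁿ index y)

vertices-unique : Unique vertices
vertices-unique = toWitness {a? = allPairs? (λ x y → ¬? (x ≟ y)) vertices} _

IsPerm? : Decidable IsPerm
IsPerm? p = all? λ i → all? λ j → (Vec.lookup p i ≟ᶠ Vec.lookup p j) →-dec (i ≟ᶠ j)

word-isPerm : ∀ x → IsPerm (word x)
word-isPerm = toWitness {a? = ∀-vertex? (IsPerm? ∘ word)} _

word-vertex : ∀ p → IsPerm p → word (vertex p) ≡ p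
word-vertex = toWitness {a? = ∀-word? λ p → IsPerm? p →-dec (word (vertex p) ≟ʷ p)} _

neighbour : V → Generator → V
neighbour p1234 = λ { g₁₂ → p2134 ; g₃⁺ → p3124 ; g₃⁻ → p2314 ; g₄⁺ → p4132 ; g₄⁻ → p2431 }
neighbour p1243 = λ { g₁₂ → p2143 ; g₃⁺ → p4123 ; g₃⁻ → p2413 ; g₄⁺ → p3142 ; g₄⁻ → p2341 }
neighbour p1324 = λ { g₁₂ → p3124 ; g₃⁺ → p2134 ; g₃⁻ → p3214 ; g₄⁺ → p4123 ; g₄⁻ → p3421 }
neighbour p1342 = λ { g₁₂ → p3142 ; g₃⁺ → p4132 ; g₃⁻ → p3412 ; g₄⁺ → p2143 ; g₄⁻ → p3241 }
neighbour p1423 = λ { g₁₂ → p4123 ; g₃⁺ → p2143 ; g₃⁻ → p4213 ; g₄⁺ → p3124 ; g₄⁻ → p4321 }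
neighbour p1432 = λ { g₁₂ → p4132 ; g₃⁺ → p3142 ; g₃⁻ → p4312 ; g₄⁺ → p2134 ; g₄⁻ → p4231 }
neighbour p2134 = λ { g₁₂ → p1234 ; g₃⁺ → p3214 ; g₃⁻ → p1324 ; g₄⁺ → p4231 ; g₄⁻ → p1432 }
neighbour p2143 = λ { g₁₂ → p1243 ; g₃⁺ → p4213 ; g₃⁻ → p1423 ; g₄⁺ → p3241 ; g₄⁻ → p1342 }
neighbour p2314 = λ { g₁₂ → p3214 ; g₃⁺ → p1234 ; g₃⁻ → p3124 ; g₄⁺ → p4213 ; g₄⁻ → p3412 }
neighbour p2341 = λ { g₁₂ → p3241 ; g₃⁺ → p4231 ; g₃⁻ → p3421 ; g₄⁺ → p1243 ; g₄⁻ → p3142 }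
neighbour p2413 = λ { g₁₂ → p4213 ; g₃⁺ → p1243 ; g₃⁻ → p4123 ; g₄⁺ → p3214 ; g₄⁻ → p4312 }
neighbour p2431 = λ { g₁₂ → p4231 ; g₃⁺ → p3241 ; g₃⁻ → p4321 ; g₄⁺ → p1234 ; g₄⁻ → p4132 }
neighbour p3124 = λ { g₁₂ → p1324 ; g₃⁺ → p2314 ; g₃⁻ → p1234 ; g₄⁺ → p4321 ; g₄⁻ → p1423 }
neighbour p3142 = λ { g₁₂ → p1342 ; g₃⁺ → p4312 ; g₃⁻ → p1432 ; g₄⁺ → p2341 ; g₄⁻ → p1243 }
neighbour p3214 = λ { g₁₂ → p2314 ; g₃⁺ → p1324 ; g₃⁻ → p2134 ; g₄⁺ → p4312 ; g₄⁻ → p2413 }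
neighbour p3241 = λ { g₁₂ → p2341 ; g₃⁺ → p4321 ; g₃⁻ → p2431 ; g₄⁺ → p1342 ; g₄⁻ → p2143 }
neighbour p3412 = λ { g₁₂ → p4312 ; g₃⁺ → p1342 ; g₃⁻ → p4132 ; g₄⁺ → p2314 ; g₄⁻ → p4213 }
neighbour p3421 = λ { g₁₂ → p4321 ; g₃⁺ → p2341 ; g₃⁻ → p4231 ; g₄⁺ → p1324 ; g₄⁻ → p4123 }
neighbour p4123 = λ { g₁₂ → p1423 ; g₃⁺ → p2413 ; g₃⁻ → p1243 ; g₄⁺ → p3421 ; g₄⁻ → p1324 }
neighbour p4132 = λ { g₁₂ → p1432 ; g₃⁺ → p3412 ; g₃⁻ → p1342 ; g₄⁺ → p2431 ; g₄⁻ → p1234 }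
neighbour p4213 = λ { g₁₂ → p2413 ; g₃⁺ → p1423 ; g₃⁻ → p2143 ; g₄⁺ → p3412 ; g₄⁻ → p2314 }
neighbour p4231 = λ { g₁₂ → p2431 ; g₃⁺ → p3421 ; g₃⁻ → p2341 ; g₄⁺ → p1432 ; g₄⁻ → p2134 }
neighbour p4312 = λ { g₁₂ → p3412 ; g₃⁺ → p1432 ; g₃⁻ → p3142 ; g₄⁺ → p2413 ; g₄⁻ → p3214 }
neighbour p4321 = λ { g₁₂ → p3421 ; g₃⁺ → p2431 ; g₃⁻ → p3241 ; g₄⁺ → p1423 ; g₄⁻ → p3124 }

word-neighbour : ∀ x k → word (neighbour x k) ≡ generator k (word x)
word-neighbour = toWitness {a? = ∀-vertex? λ x → ∀-generator? λ k →
  word (neighbour x k) ≟ʷ generator k (word x)} _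

record Table (A : Set) : Set where
  constructor table
  field
    at1234 at1243 at1324 at1342 at1423 at1432 at2134 at2143 at2314 at2341 at2413 at2431 : A
    at3124 at3142 at3214 at3241 at3412 at3421 at4123 at4132 at4213 at4231 at4312 at4321 : A

memo : {A : Set} → (V → A) → Table A
memo f = table
  (f p1234) (f p1243) (f p1324) (f p1342) (f p1423) (f p1432)
  (f p2134) (f p2143) (f p2314) (f p2341) (f p2413) (f p2431)
  (f p3124) (f p3142) (f p3214) (f p3241) (f p3412) (f p3421)
  (f p4123) (f p4132) (f p4213) (f p4231) (f p4312) (f p4321)

_!_ : {A : Set} → Table A → V → A
t ! p1234 = Table.at1234 t
t ! p1243 = Table.at1243 t
t ! p1324 = Table.at1324 t
t ! p1342 = Table.at1342 t
t ! p1423 = Table.at1423 t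
t ! p1432 = Table.at1432 t
t ! p2134 = Table.at2134 t
t ! p2143 = Table.at2143 t
t ! p2314 = Table.at2314 t
t ! p2341 = Table.at2341 t
t ! p2413 = Table.at2413 t
t ! p2431 = Table.at2431 t
t ! p3124 = Table.at3124 t
t ! p3142 = Table.at3142 t
t ! p3214 = Table.at3214 t
t ! p3241 = Table.at3241 t
t ! p3412 = Table.at3412 t
t ! p3421 = Table.at3421 t
t ! p4123 = Table.at4123 t
t ! p4132 = Table.at4132 t
t ! p4213 = Table.at4213 t
t ! p4231 = Table.at4231 t
t ! p4312 = Table.at4312 t
t ! p4321 = Table.at4321 t

memo-! : {A : Set} (f : V → A) (x : V) → memo f ! x ≡ f x
memo-! f p1234 = refl
memo-! f p1243 = refl
memo-! f p1324 = refl
memo-! f p1342 = refl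
memo-! f p1423 = refl
memo-! f p1432 = refl
memo-! f p2134 = refl
memo-! f p2143 = refl
memo-! f p2314 = refl
memo-! f p2341 = refl
memo-! f p2413 = refl
memo-! f p2431 = refl
memo-! f p3124 = refl
memo-! f p3142 = refl
memo-! f p3214 = refl
memo-! f p3241 = refl
memo-! f p3412 = refl
memo-! f p3421 = refl
memo-! f p4123 = refl
memo-! f p4132 = refl
memo-! f p4213 = refl
memo-! f p4231 = refl
memo-! f p4312 = refl
memo-! f p4321 = refl

inverse : Word → Fin 4 → Fin 4
inverse p a with any? (λ i → Vec.lookup p i ≟ᶠ a)
... | yes (i , _) = i
... | no _        = a

inverse-lookup : ∀ x i → inverse (word x) (Vec.lookup (word x) i) ≡ i
inverse-lookup = toWitness {a? = ∀-vertex? λ x → all? λ i → inverse (word x) (Vec.lookup (word x) i) ≟ᶠ i} _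

lookup-inverse : ∀ x a → Vec.lookup (word x) (inverse (word x) a) ≡ a
lookup-inverse = toWitness {a? = ∀-vertex? λ x → all? λ a → Vec.lookup (word x) (inverse (word x) a) ≟ᶠ a} _

relabel-inverse-word : ∀ x → relabel (inverse (word x)) (word x) ≡ word p1234
relabel-inverse-word = toWitness {a? = ∀-vertex? λ x → relabel (inverse (word x)) (word x) ≟ʷ word p1234} _

-- Lower bounds on κ_ℓ

normalise-components : ∀ {m S} → AtLeastComponents (suc m) S →
  ∃ λ S′ → length S′ ≡ length S ×
    Σ (Fin (suc m) → Word) λ v → Representatives (suc m) S′ v × v zero ≡ word p1234
normalise-components {S = S} (v , representatives@(perm , _)) =
  map (relabel σ) S , length-map (relabel σ) S , relabel σ ∘ v ,
  relabel-representatives σ (Vec.lookup (word u)) (inverse-lookup u) (lookup-inverse u) representatives ,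
  trans (cong (relabel σ) (sym (word-vertex (v zero) (perm zero)))) (relabel-inverse-word u)
  where
  u = vertex (v zero)
  σ = inverse (word u)

open Search _≟_ vertices generators neighbour memo _!_ memo-!

-- Each step of the search fixes a previously unknown vertex.
fuel : ℕ
fuel = 25

Certificate : ℕ → ℕ → Set
Certificate m K = all (λ ys → check K fuel (initial (p1234 ∷ ys))) (combinations m others) ≡ true

∈-others : ∀ {x} → x ≢ p1234 → x ∈ others
∈-others {x} x≢p1234 = Any.tail x≢p1234 (vertices-complete x)

words-⊆⇒length≤ : ∀ {S xs} → Unique xs → All (λ x → word x ∈ S) xs → length xs ≤ length S
words-⊆⇒length≤ {S} {xs} unique words-in-S = subst (_≤ length S) (length-map word xs)
  (unique-⊆⇒length≤ (Unique.map⁺ word-injective unique) (All.lookup (All-map⁺ words-in-S)))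

module _ {m S} (v : Fin (suc m) → Word) (perm : ∀ i → IsPerm (v i)) (outside : ∀ i → v i ∉ S)
         (apart : ∀ i j → ¬ i ≡ j → ¬ Connected S (v i) (v j)) (v₀ : v zero ≡ word p1234) where

  terminal : Fin (suc m) → V
  terminal i = vertex (v i)

  word-terminal : ∀ i → word (terminal i) ≡ v i
  word-terminal i = word-vertex (v i) (perm i)

  terminal-injective : ∀ {i j} → terminal i ≡ terminal j → i ≡ j
  terminal-injective {i} {j} eq = decidable-stable (i ≟ᶠ j) λ i≢j → apart i j i≢j
    (subst (Connected S (v i)) (trans (sym (word-terminal i)) (trans (cong word eq) (word-terminal j))) ε)

  terminal-zero : terminal zero ≡ p1234
  terminal-zero = trans (cong vertex v₀) (vertex-word p1234)

  IsTerminal : V → Set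
  IsTerminal a = ∃ λ i → terminal i ≡ a

  IsTerminal? : Decidable IsTerminal
  IsTerminal? a = any? λ i → terminal i ≟ a

  -- the other terminals, as a sublist of others, so that the certificate covers them
  chosen : List V
  chosen = take m (filter IsTerminal? others)

  m≤terminals : m ≤ length (filter IsTerminal? others)
  m≤terminals = subst (_≤ length (filter IsTerminal? others)) (length-tabulate (terminal ∘ suc))
    (unique-⊆⇒length≤ (Unique.tabulate⁺ (suc-injective ∘ terminal-injective)) λ a∈ →
      let (i , a≡) = ∈-tabulate⁻ a∈ in subst (_∈ filter IsTerminal? others) (sym a≡) (later-terminal-∈ i))
    where
    later-terminal-∈ : ∀ i → terminal (suc i) ∈ filter IsTerminal? others
    later-terminal-∈ i = ∈-filter⁺ IsTerminal?
      (∈-others λ eq → contradiction (terminal-injective (trans eq (sym terminal-zero))) λ ()) (suc i , refl)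

  chosen-checked : ∀ {K} → Certificate m K → T (check K fuel (initial (p1234 ∷ chosen)))
  chosen-checked certificate = All.lookup (all⁺ _ _ (Equivalence.from T-≡ certificate))
    (subst (λ k → chosen ∈ combinations k others) (trans (length-take m _) (m≤n⇒m⊓n≡m m≤terminals))
      (sublist-∈-combinations (⊆-trans (take-⊆ m _) (filter-⊆ IsTerminal? others))))

  chosen-terminal : All IsTerminal (p1234 ∷ chosen)
  chosen-terminal = (zero , terminal-zero) ∷ take⁺ m (all-filter IsTerminal? others)

  terminal-outside : ∀ {a} → IsTerminal a → word a ∉ S
  terminal-outside (i , refl) = subst (_∉ S) (sym (word-terminal i)) (outside i)

  terminals-separated : ∀ {a b} → IsTerminal a → IsTerminal b → a ≢ b → ¬ Connected S (word a) (word b)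
  terminals-separated (i , refl) (j , refl) a≢b = subst₂ (λ p q → ¬ Connected S p q)
    (sym (word-terminal i)) (sym (word-terminal j)) (apart i j λ { refl → a≢b refl })

  neighbour-connected : ∀ {x} k → word x ∉ S → word (neighbour x k) ∉ S →
                        Connected S (word x) (word (neighbour x k))
  neighbour-connected {x} k x∉S y∉S =
    (word-isPerm x , word-isPerm (neighbour x k) , x∉S , y∉S ,
     subst (Adj (word x)) (sym (word-neighbour x k)) (generator⇒adj k (word x))) ◅ ε

  certificate⇒bound : ∀ {K} → Certificate m K → K ≤ length S
  certificate⇒bound {K} certificate = Soundness.sound-initial K (p1234 ∷ chosen)
    (λ x → word x ∈ S) (λ x → member? _≟ʷ_ (word x) S)
    (λ a x → Connected S (word a) (word x)) ε connected-sym _◅◅_ neighbour-connected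
    (terminal-outside ∘ All.lookup chosen-terminal)
    (λ a∈ b∈ → terminals-separated (All.lookup chosen-terminal a∈) (All.lookup chosen-terminal b∈))
    (length S) words-⊆⇒length≤ vertices-unique fuel (chosen-checked certificate)

fewerVertices⇒bound : ∀ {ℓ K S} → K + ℓ ≤ 25 → FewerVertices ℓ S → K ≤ length S
fewerVertices⇒bound {ℓ} {K} {S} room fewer with K ≤? length S
... | yes K≤ = K≤
... | no K≰  = contradiction (w , (λ {i} {j} → w-injective) , word-isPerm ∘ pick , w-outside) fewer
  where
  Outside? : Decidable (λ x → word x ∉ S)
  Outside? x = ¬? (member? _≟ʷ_ (word x) S)

  outside : List V
  outside = filter Outside? vertices

  inside-or-outside : ∀ {x} → x ∈ vertices → word x ∈ S ++ map word outside
  inside-or-outside {x} x∈ with member? _≟ʷ_ (word x) S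
  ... | yes x∈S = ∈-++⁺ˡ x∈S
  ... | no x∉S  = ∈-++⁺ʳ S (∈-map⁺ word (∈-filter⁺ Outside? x∈ x∉S))

  24≤S+outside : 24 ≤ length S + length outside
  24≤S+outside = subst (24 ≤_) (trans (length-++ S) (cong (length S +_) (length-map word outside)))
    (unique-⊆⇒length≤ (Unique.map⁺ word-injective vertices-unique) λ p∈ →
      let (x , x∈ , p≡) = ∈-map⁻ word p∈ in subst (_∈ _) (sym p≡) (inside-or-outside x∈))

  enough : ℓ ≤ length outside
  enough = +-cancelˡ-≤ K ℓ (length outside)
    (≤-trans room (≤-trans (s≤s 24≤S+outside) (+-monoˡ-≤ (length outside) (≰⇒> K≰))))

  pick : Fin ℓ → V
  pick i = lookup outside (inject≤ i enough)

  w : Fin ℓ → Word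
  w = word ∘ pick

  w-injective : ∀ {i j} → w i ≡ w j → i ≡ j
  w-injective {i} {j} eq = inject≤-injective enough enough i j
    (lookup-injective (Unique.filter⁺ Outside? vertices-unique) _ _ (word-injective eq))

  w-outside : ∀ i → w i ∉ S
  w-outside i = proj₂ (∈-filter⁻ Outside? {xs = vertices} (∈-lookup {xs = outside} (inject≤ i enough)))

κ≥-from-certificate : ∀ m K → K + suc m ≤ 25 → Certificate m K → κ≥ (suc m) K
κ≥-from-certificate m K room certificate S _ _ (inj₂ fewer) = fewerVertices⇒bound room fewer
κ≥-from-certificate m K room certificate S _ _ (inj₁ components) =
  let (S′ , length-S′ , v , (perm , outside , apart) , v₀) = normalise-components components
  in subst (K ≤_) length-S′ (certificate⇒bound v perm outside apart v₀ certificate)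

lemma19 : κ≥ 4 10 × κ≥ 5 12
lemma19 = κ≥-from-certificate 3 10 (m≤m+n 14 11) refl , κ≥-from-certificate 4 12 (m≤m+n 17 8) refl
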